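{- Let $X$ be a finite set with $|X|\ge 3$ and let $T$ be a binary phylogenetic $X$-tree. If $\mathcal T$ is a minimal triplet cover of $T$, then $|\mathcal T|\le 3(|X|-2)$.
   Context: A binary phylogenetic $X$-tree is an unrooted tree whose leaf set is $X$ and in which every non-leaf (interior) vertex has degree $3$. For $\mathcal T\subseteq\binom{X}{2}$ and an interior vertex $v$, a triple $\{a,b,c\}\subseteq X$ supports $v$ if $a,b,c$ lie one in each of the three components of $T$ minus $v$ and $\{a,b\},\{a,c\},\{b,c\}\in\mathcal T$. $\mathcal T$ is a triplet cover for $T$ if every interior vertex is supported by some triple. A triplet cover $\mathcal T$ is minimal if $\mathcal T-\{p\}$ is not a triplet cover for $T$ for any $p\in\mathcal T$. -}

module Defs where

open import Data.Nat using (ℕ; _≤_; _<_)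
open import Data.Fin using (Fin; toℕ)
open import Data.Fin.Properties renaming (_≟_ to _≟ᶠ_)
open import Data.Bool using (Bool; true; false; if_then_else_; T)
open import Data.Sum using (_⊎_; inj₁; inj₂)
open import Data.Product using (Σ; ∃; ∃-syntax; _×_; _,_)
open import Data.Product.Properties using (≡-dec)
open import Data.List using (List; []; _∷_; _++_; map; length; filter; allFin)
open import Data.Nat.ListAction using (sum)
open import Data.List.Membership.Propositional using (_∈_)
open import Data.List.Relation.Unary.All using (All)
open import Data.List.Relation.Unary.Unique.Propositional using (Unique)
open import Data.List.Relation.Unary.Linked using (Linked)
open import Data.Empty using (⊥)
open import Data.Unit using (⊤)
open import Relation.Nullary using (¬_; ¬?)
open import Relation.Binary.PropositionalEquality using (_≡_; _≢_)

-- Vertices of a tree with leaf set X = Fin n and k interior vertices: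
-- leaves are  inj₁ x  (x ∈ X), interior vertices are  inj₂ i.
Vtx : ℕ → ℕ → Set
Vtx n k = Fin n ⊎ Fin k

allVtx : (n k : ℕ) → List (Vtx n k)
allVtx n k = map inj₁ (allFin n) ++ map inj₂ (allFin k)

data Walk {V : Set} (adj : V → V → Bool) (ok : V → Set) : V → V → Set where
  stop : ∀ {u} → ok u → Walk adj ok u u
  step : ∀ {u w x} → ok u → T (adj u w) → Walk adj ok w x → Walk adj ok u x

HasCycle : {V : Set} → (V → V → Bool) → Set
HasCycle {V} adj =
  Σ V λ u → Σ (List V) λ rest →
    (2 ≤ length rest) × Unique (u ∷ rest) ×
    Linked (λ a b → T (adj a b)) (u ∷ rest ++ u ∷ [])

record BinaryPhyloTree (n k : ℕ) : Set where
  field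
    adj       : Vtx n k → Vtx n k → Bool
    adj-sym   : ∀ u w → adj u w ≡ adj w u
    adj-irr   : ∀ u → adj u u ≡ false
    connected : ∀ u w → Walk adj (λ _ → ⊤) u w
    acyclic   : ¬ HasCycle adj
  degree : Vtx n k → ℕ
  degree v = sum (map (λ w → if adj v w then 1 else 0) (allVtx n k))
  field
    leaf-deg     : ∀ x → degree (inj₁ x) ≡ 1
    interior-deg : ∀ i → degree (inj₂ i) ≡ 3

open BinaryPhyloTree public

Separated : ∀ {n k} → BinaryPhyloTree n k → Vtx n k → Vtx n k → Vtx n k → Set
Separated T v x y = ¬ Walk (adj T) (λ u → u ≢ v) x y

-- A set of 2-subsets of X, represented as a duplicate-free list of pairs (a , b)
-- with a < b.
PairSet : ℕ → Set
PairSet n = List (Fin n × Fin n)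

WellFormedPairSet : ∀ {n} → PairSet n → Set
WellFormedPairSet 𝒯 = All (λ { (a , b) → toℕ a < toℕ b }) 𝒯 × Unique 𝒯

_∈ᵖ_ : ∀ {n} → Fin n × Fin n → PairSet n → Set
(a , b) ∈ᵖ 𝒯 = ((a , b) ∈ 𝒯) ⊎ ((b , a) ∈ 𝒯)

Supports : ∀ {n k} → BinaryPhyloTree n k → PairSet n → Fin n → Fin n → Fin n → Vtx n k → Set
Supports T 𝒯 a b c v =
  Separated T v (inj₁ a) (inj₁ b) × Separated T v (inj₁ a) (inj₁ c) ×
  Separated T v (inj₁ b) (inj₁ c) ×
  (a , b) ∈ᵖ 𝒯 × (a , c) ∈ᵖ 𝒯 × (b , c) ∈ᵖ 𝒯

IsTripletCover : ∀ {n k} → BinaryPhyloTree n k → PairSet n → Set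
IsTripletCover {n} T 𝒯 = ∀ i → ∃[ a ] ∃[ b ] ∃[ c ] Supports T 𝒯 a b c (inj₂ i)

removePair : ∀ {n} → Fin n × Fin n → PairSet n → PairSet n
removePair p = filter (λ q → ¬? (≡-dec _≟ᶠ_ _≟ᶠ_ q p))

IsMinimalTripletCover : ∀ {n k} → BinaryPhyloTree n k → PairSet n → Set
IsMinimalTripletCover T 𝒯 =
  IsTripletCover T 𝒯 × (∀ p → p ∈ 𝒯 → ¬ IsTripletCover T (removePair p 𝒯))

-- Choose one supporting triple for every interior vertex. By minimality every pair
-- of the cover occurs in one of the chosen triples, since otherwise removing it would
-- leave a cover; so a minimal cover has at most 3k pairs, k the number of interior
-- vertices. As the tree is acyclic, its degree sum n + 3k is at most 2(n + k - 1):
-- a nonempty forest has a vertex of degree at most one, and deleting it removes at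
-- most one edge. Hence k ≤ n - 2.
module Submission where

open import Defs
open import Data.Bool using (Bool; true; false; if_then_else_; T)
open import Data.Empty using (⊥-elim)
open import Data.Fin using (Fin)
open import Data.Fin.Properties using () renaming (_≟_ to _≟ᶠ_)
open import Data.List
  using (List; []; _∷_; _++_; map; filter; length; concatMap; allFin)
open import Data.List.Properties
  using (filter-all; filter-accept; filter-reject; filter-notAll;
         length-++; length-map; length-tabulate; map-++; map-∘; map-cong)
open import Data.List.Membership.Propositional using (_∈_; _∉_; find)
open import Data.List.Membership.Propositional.Properties
  using (∈-allFin; ∈-filter⁺; ∈-filter⁻; ∈-∃++; ∈-map⁺; ∈-map⁻; ∈-++⁺ʳ; ∈-concat⁺′)
open import Data.List.Relation.Binary.Permutation.Propositional
  using (_↭_; prep; swap; ↭-refl; ↭-reflexive; module PermutationReasoning)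
open import Data.List.Relation.Binary.Permutation.Propositional.Properties
  using (↭-length) renaming (map⁺ to ↭-map⁺)
open import Data.List.Relation.Binary.Subset.Propositional using (_⊆_)
open import Data.List.Relation.Binary.Subset.Propositional.Properties using (∈-∷⁺ʳ)
open import Data.List.Relation.Unary.All as All using ([]; _∷_)
open import Data.List.Relation.Unary.All.Properties using (¬Any⇒All¬; ++⁻ˡ)
open import Data.List.Relation.Unary.Any as Any using (here; there; any?)
open import Data.List.Relation.Unary.AllPairs using ([]; _∷_)
open import Data.List.Relation.Unary.Linked using (Linked; [-]; _∷_)
open import Data.List.Relation.Unary.Unique.Propositional using (Unique)
open import Data.List.Relation.Unary.Unique.Propositional.Properties
  using (filter⁺; allFin⁺) renaming (map⁺ to Unique-map⁺; ++⁺ to Unique-++⁺)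
open import Data.Nat
  using (ℕ; zero; suc; pred; _+_; _*_; _∸_; _≤_; _<_; z≤n; s≤s; _≤?_)
open import Data.Nat.Induction using (<-wellFounded)
open import Data.Nat.ListAction using (sum)
open import Data.Nat.ListAction.Properties using (sum-++; sum-↭)
open import Data.Nat.Properties
open import Data.Nat.Tactic.RingSolver using (solve-∀)
open import Data.Product using (∃-syntax; _×_; _,_)
open import Data.Product.Properties using (≡-dec)
open import Data.Sum using (inj₁; inj₂)
open import Data.Sum.Properties using (inj₁-injective; inj₂-injective)
  renaming (≡-dec to ⊎-≡-dec)
open import Function using (_∘_; id)
open import Induction.WellFounded using (Acc; acc)
open import Relation.Binary using (DecidableEquality)
open import Relation.Binary.PropositionalEquality
  using (_≡_; _≢_; refl; sym; trans; subst; cong; cong₂; ≢-sym; module ≡-Reasoning)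
open import Relation.Nullary using (¬_; ¬?; yes; no)

sum-map-+ : {A : Set} (f g : A → ℕ) (xs : List A) →
  sum (map (λ x → f x + g x) xs) ≡ sum (map f xs) + sum (map g xs)
sum-map-+ f g [] = refl
sum-map-+ f g (x ∷ xs) rewrite sum-map-+ f g xs =
  solve (f x) (g x) (sum (map f xs)) (sum (map g xs))
  where
  solve : ∀ a b c d → a + b + (c + d) ≡ a + c + (b + d)
  solve = solve-∀

sum-map-const : {A : Set} (f : A → ℕ) {c : ℕ} → (∀ x → f x ≡ c) →
  (xs : List A) → sum (map f xs) ≡ length xs * c
sum-map-const f fx≡c [] = refl
sum-map-const f fx≡c (x ∷ xs) = cong₂ _+_ (fx≡c x) (sum-map-const f fx≡c xs)

sum-map-↭ : {A : Set} (f : A → ℕ) {xs ys : List A} → xs ↭ ys →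
  sum (map f xs) ≡ sum (map f ys)
sum-map-↭ f = sum-↭ ∘ ↭-map⁺ f

length-concatMap-const : {A B : Set} (f : A → List B) {c : ℕ} →
  (∀ x → length (f x) ≡ c) → (xs : List A) → length (concatMap f xs) ≡ length xs * c
length-concatMap-const f fx≡c [] = refl
length-concatMap-const f fx≡c (x ∷ xs) =
  trans (length-++ (f x)) (cong₂ _+_ (fx≡c x) (length-concatMap-const f fx≡c xs))

Linked-++⁻ˡ : {A : Set} {R : A → A → Set} (xs : List A) {y : A} {ys : List A} →
  Linked R (xs ++ y ∷ ys) → Linked R (xs ++ y ∷ [])
Linked-++⁻ˡ [] _ = [-]
Linked-++⁻ˡ (x ∷ []) (r ∷ _) = r ∷ [-]
Linked-++⁻ˡ (x ∷ x′ ∷ xs) (r ∷ rs) = r ∷ Linked-++⁻ˡ (x′ ∷ xs) rs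

Unique-++⁻-middle : {A : Set} (xs : List A) {y : A} {ys : List A} →
  Unique (xs ++ y ∷ ys) → Unique (y ∷ xs)
Unique-++⁻-middle [] _ = [] ∷ []
Unique-++⁻-middle (x ∷ xs) (x∉ ∷ u) with y∉xs ∷ uxs ← Unique-++⁻-middle xs u =
  (≢-sym (All.lookup x∉ (∈-++⁺ʳ xs (here refl))) ∷ y∉xs) ∷ ++⁻ˡ xs x∉ ∷ uxs

module Without {A : Set} (_≟_ : DecidableEquality A) where

  _without_ : List A → A → List A
  xs without v = filter (λ u → ¬? (u ≟ v)) xs

  ∈-without⁺ : ∀ {u v xs} → u ∈ xs → u ≢ v → u ∈ xs without v
  ∈-without⁺ {v = v} = ∈-filter⁺ (λ u → ¬? (u ≟ v))

  ∈-without⁻ : ∀ {u v xs} → u ∈ xs without v → u ∈ xs × u ≢ v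
  ∈-without⁻ {v = v} = ∈-filter⁻ (λ u → ¬? (u ≟ v))

  Unique-without : ∀ {v xs} → Unique xs → Unique (xs without v)
  Unique-without {v} = filter⁺ (λ u → ¬? (u ≟ v))

  length-without< : ∀ {v xs} → v ∈ xs → length (xs without v) < length xs
  length-without< {v} {xs} v∈xs =
    filter-notAll (λ u → ¬? (u ≟ v)) xs (Any.map (λ v≡u u≢v → u≢v (sym v≡u)) v∈xs)

  ↭-without : ∀ {v xs} → Unique xs → v ∈ xs → xs ↭ v ∷ xs without v
  ↭-without (x∉xs ∷ _) (here refl) =
    prep _ (↭-reflexive (sym (trans (filter-reject (λ u → ¬? (u ≟ _)) (λ v≢v → v≢v refl))
                                     (filter-all (λ u → ¬? (u ≟ _)) (All.map ≢-sym x∉xs)))))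
  ↭-without {v} {x ∷ xs} (x∉xs ∷ u) (there v∈xs) = begin
    x ∷ xs                ↭⟨ prep x (↭-without u v∈xs) ⟩
    x ∷ v ∷ xs without v  ↭⟨ swap x v ↭-refl ⟩
    v ∷ x ∷ xs without v  ≡⟨ cong (v ∷_) (sym (filter-accept (λ w → ¬? (w ≟ v))
                                                            (All.lookup x∉xs v∈xs))) ⟩
    v ∷ (x ∷ xs) without v ∎
    where open PermutationReasoning

  unique⊆⇒length≤ : ∀ {xs ys} → Unique xs → xs ⊆ ys → length xs ≤ length ys
  unique⊆⇒length≤ [] _ = z≤n
  unique⊆⇒length≤ (x∉xs ∷ u) xs⊆ys =
    ≤-trans (s≤s (unique⊆⇒length≤ u λ w∈xs →
                   ∈-without⁺ (xs⊆ys (there w∈xs)) (≢-sym (All.lookup x∉xs w∈xs))))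
            (length-without< (xs⊆ys (here refl)))

module Forest {V : Set} (_≟_ : DecidableEquality V) (adj : V → V → Bool)
  (adj-sym : ∀ u w → adj u w ≡ adj w u) (adj-irr : ∀ u → adj u u ≡ false)
  (acyclic : ¬ HasCycle adj) where

  open Without _≟_
  open import Data.List.Membership.DecPropositional _≟_ using (_∈?_)

  _~_ : V → V → Set
  u ~ w = T (adj u w)

  ~-sym : ∀ {u w} → u ~ w → w ~ u
  ~-sym {u} {w} rewrite adj-sym u w = λ w~u → w~u

  ~-irrefl : ∀ {u} → ¬ u ~ u
  ~-irrefl {u} rewrite adj-irr u = λ ()

  edge : V → V → ℕ
  edge u w = if adj u w then 1 else 0

  edge-sym : ∀ u w → edge u w ≡ edge w u
  edge-sym u w rewrite adj-sym u w = refl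

  edge-irr : ∀ u → edge u u ≡ 0
  edge-irr u rewrite adj-irr u = refl

  edge≤1 : ∀ u w → edge u w ≤ 1
  edge≤1 u w with adj u w
  ... | true = ≤-refl
  ... | false = z≤n

  degreeIn : List V → V → ℕ
  degreeIn vs v = sum (map (edge v) vs)

  degreeSum : List V → ℕ
  degreeSum vs = sum (map (degreeIn vs) vs)

  degreeIn≤length : ∀ vs v → degreeIn vs v ≤ length vs
  degreeIn≤length [] v = z≤n
  degreeIn≤length (w ∷ vs) v = +-mono-≤ (edge≤1 v w) (degreeIn≤length vs v)

  degreeIn-without : ∀ {u vs} v → Unique vs → u ∈ vs →
    degreeIn vs v ≡ edge v u + degreeIn (vs without u) v
  degreeIn-without v uvs u∈vs = sum-map-↭ (edge v) (↭-without uvs u∈vs)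

  degreeIn-without-self : ∀ {v vs} → Unique vs → v ∈ vs → degreeIn vs v ≡ degreeIn (vs without v) v
  degreeIn-without-self {v} {vs} uvs v∈vs =
    trans (degreeIn-without v uvs v∈vs) (cong (_+ degreeIn (vs without v) v) (edge-irr v))

  degreeSum-without : ∀ {v vs} → Unique vs → v ∈ vs →
    let ws = vs without v in
    degreeSum vs ≡ degreeIn ws v + degreeIn ws v + degreeSum ws
  degreeSum-without {v} {vs} uvs v∈vs = begin
    degreeSum vs
      ≡⟨ sum-map-↭ (degreeIn vs) (↭-without uvs v∈vs) ⟩
    degreeIn vs v + sum (map (degreeIn vs) ws)
      ≡⟨ cong₂ _+_ (degreeIn-without-self uvs v∈vs)
                   (cong sum (map-cong (λ w → degreeIn-without w uvs v∈vs) ws)) ⟩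
    D + sum (map (λ w → edge w v + degreeIn ws w) ws)
      ≡⟨ cong (D +_) (sum-map-+ (λ w → edge w v) (degreeIn ws) ws) ⟩
    D + (sum (map (λ w → edge w v) ws) + degreeSum ws)
      ≡⟨ cong (λ s → D + (s + degreeSum ws)) (cong sum (map-cong (λ w → edge-sym w v) ws)) ⟩
    D + (D + degreeSum ws)
      ≡⟨ sym (+-assoc D D (degreeSum ws)) ⟩
    D + D + degreeSum ws ∎
    where
    open ≡-Reasoning
    ws = vs without v
    D = degreeIn ws v

  neighbour : ∀ {x} vs → 1 ≤ degreeIn vs x → ∃[ y ] y ∈ vs × x ~ y
  neighbour {x} (w ∷ vs) deg≥1 with adj x w in x~w
  ... | true = w , here refl , subst T (sym x~w) _
  ... | false with y , y∈vs , x~y ← neighbour vs deg≥1 = y , there y∈vs , x~y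

  pred-degreeIn≤degreeIn-without : ∀ {p vs} x → Unique vs → p ∈ vs →
    pred (degreeIn vs x) ≤ degreeIn (vs without p) x
  pred-degreeIn≤degreeIn-without {p} x uvs p∈vs =
    pred-mono-≤ (≤-trans (≤-reflexive (degreeIn-without x uvs p∈vs)) (+-monoˡ-≤ _ (edge≤1 x p)))

  neighbour-≢ : ∀ {x vs} p → Unique vs → 2 ≤ degreeIn vs x → ∃[ y ] y ∈ vs × x ~ y × y ≢ p
  neighbour-≢ {x} {vs} p uvs deg≥2 with p ∈? vs
  ... | no p∉vs with y , y∈vs , x~y ← neighbour vs (≤-trans (s≤s z≤n) deg≥2) =
    y , y∈vs , x~y , λ { refl → p∉vs y∈vs }
  ... | yes p∈vs
    with y , y∈ws , x~y ←
           neighbour (vs without p)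
             (≤-trans (pred-mono-≤ deg≥2) (pred-degreeIn≤degreeIn-without x uvs p∈vs))
    with y∈vs , y≢p ← ∈-without⁻ {xs = vs} y∈ws = y , y∈vs , x~y , y≢p

  IsPathIn : List V → List V → Set
  IsPathIn vs xs = Unique xs × xs ⊆ vs × Linked _~_ xs

  chord⇒cycle : ∀ {x p y rest} → Unique (x ∷ p ∷ rest) → Linked _~_ (x ∷ p ∷ rest) →
    y ∈ rest → x ~ y → HasCycle adj
  chord⇒cycle {x} {p} {y} u lk y∈rest x~y with as , bs , refl ← ∈-∃++ y∈rest =
    y , x ∷ p ∷ as , s≤s (s≤s z≤n) ,
    Unique-++⁻-middle (x ∷ p ∷ as) u , ~-sym x~y ∷ Linked-++⁻ˡ (x ∷ p ∷ as) lk

  extend-path : ∀ {vs x p rest} → Unique vs → (∀ {v} → v ∈ vs → 2 ≤ degreeIn vs v) →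
    IsPathIn vs (x ∷ p ∷ rest) → ∃[ y ] IsPathIn vs (y ∷ x ∷ p ∷ rest)
  extend-path {x = x} {p} {rest} uvs deg≥2 (u , path⊆vs , lk)
    with y , y∈vs , x~y , y≢p ← neighbour-≢ p uvs (deg≥2 (path⊆vs (here refl)))
    with y ∈? (x ∷ p ∷ rest)
  ... | no y∉path =
    y , ¬Any⇒All¬ _ y∉path ∷ u , ∈-∷⁺ʳ y∈vs path⊆vs , ~-sym x~y ∷ lk
  ... | yes (here refl) = ⊥-elim (~-irrefl x~y)
  ... | yes (there (here refl)) = ⊥-elim (y≢p refl)
  ... | yes (there (there y∈rest)) = ⊥-elim (acyclic (chord⇒cycle u lk y∈rest x~y))

  long-path : ∀ {vs v} → Unique vs → (∀ {v} → v ∈ vs → 2 ≤ degreeIn vs v) → v ∈ vs →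
    ∀ m → ∃[ x ] ∃[ p ] ∃[ rest ] IsPathIn vs (x ∷ p ∷ rest) × m ≤ length rest
  long-path {vs} {v} uvs deg≥2 v∈vs zero
    with w , w∈vs , v~w ← neighbour vs (≤-trans (s≤s z≤n) (deg≥2 v∈vs)) =
    w , v , [] , (((λ { refl → ~-irrefl v~w }) ∷ []) ∷ [] ∷ [] ,
                  ∈-∷⁺ʳ w∈vs (∈-∷⁺ʳ v∈vs λ ()) , ~-sym v~w ∷ [-]) , z≤n
  long-path uvs deg≥2 v∈vs (suc m)
    with x , p , rest , path , m≤ ← long-path uvs deg≥2 v∈vs m
    with y , path′ ← extend-path uvs deg≥2 path =
    y , x , p ∷ rest , path′ , s≤s m≤

  ∃-leaf : ∀ {vs v} → Unique vs → v ∈ vs → ∃[ w ] w ∈ vs × degreeIn vs w ≤ 1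
  ∃-leaf {vs} uvs v∈vs with any? (λ w → degreeIn vs w ≤? 1) vs
  ... | yes leaf = find leaf
  ... | no no-leaf
    with _ , _ , rest , (u , path⊆vs , _) , len≤ ←
           long-path uvs (λ w∈vs → ≰⇒> (All.lookup (¬Any⇒All¬ vs no-leaf) w∈vs)) v∈vs (length vs)
    = ⊥-elim (1+n≰n (≤-trans (n≤1+n _) (≤-trans (unique⊆⇒length≤ u path⊆vs) len≤)))

  degreeSum≤2*pred[length] : ∀ vs → Unique vs → degreeSum vs ≤ 2 * pred (length vs)
  degreeSum≤2*pred[length] vs = go vs (<-wellFounded (length vs))
    where
    leaf-step : ∀ {d l s} → d ≤ 1 → d ≤ l → s ≤ 2 * pred l → d + d + s ≤ 2 * l
    leaf-step {l = zero} _ z≤n z≤n = z≤n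
    leaf-step {d} {suc l} {s} d≤1 _ s≤ = begin
      d + d + s       ≤⟨ +-mono-≤ (+-mono-≤ d≤1 d≤1) s≤ ⟩
      2 + 2 * l       ≡⟨ sym (*-suc 2 l) ⟩
      2 * suc l       ∎
      where open ≤-Reasoning

    go : ∀ vs → Acc _<_ (length vs) → Unique vs → degreeSum vs ≤ 2 * pred (length vs)
    go [] _ _ = z≤n
    go vs@(_ ∷ _) (acc rec) uvs with v , v∈vs , deg≤1 ← ∃-leaf uvs (here refl) = begin
      degreeSum vs
        ≡⟨ degreeSum-without uvs v∈vs ⟩
      D + D + degreeSum ws
        ≤⟨ leaf-step (≤-trans (≤-reflexive (sym (degreeIn-without-self uvs v∈vs))) deg≤1)
                     (degreeIn≤length ws v)
                     (go ws (rec (length-without< v∈vs)) (Unique-without uvs)) ⟩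
      2 * length ws
        ≡⟨ cong (λ l → 2 * pred l) (sym (↭-length (↭-without uvs v∈vs))) ⟩
      2 * pred (length vs) ∎
      where
      open ≤-Reasoning
      ws = vs without v
      D = degreeIn ws v

n+3*k≤2*pred[n+k]⇒k≤n∸2 : ∀ n k → n + 3 * k ≤ 2 * pred (n + k) → k ≤ n ∸ 2
n+3*k≤2*pred[n+k]⇒k≤n∸2 n zero _ = z≤n
n+3*k≤2*pred[n+k]⇒k≤n∸2 n (suc k) h =
  m+n≤o⇒m≤o∸n (suc k) (+-cancelˡ-≤ (n + 2 * k) (suc k + 2) n (begin
    n + 2 * k + (suc k + 2) ≡⟨ lhs n k ⟩
    n + 3 * suc k           ≤⟨ h ⟩
    2 * pred (n + suc k)    ≡⟨ cong (λ m → 2 * pred m) (+-suc n k) ⟩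
    2 * (n + k)             ≡⟨ rhs n k ⟩
    n + 2 * k + n           ∎))
  where
  open ≤-Reasoning
  lhs : ∀ n k → n + 2 * k + (suc k + 2) ≡ n + 3 * suc k
  lhs = solve-∀
  rhs : ∀ n k → 2 * (n + k) ≡ n + 2 * k + n
  rhs = solve-∀

length-allFin : ∀ n → length (allFin n) ≡ n
length-allFin n = length-tabulate id

Unique-allVtx : ∀ n k → Unique (allVtx n k)
Unique-allVtx n k =
  Unique-++⁺ (Unique-map⁺ inj₁-injective (allFin⁺ n)) (Unique-map⁺ inj₂-injective (allFin⁺ k))
    λ (v∈leaves , v∈interior) → leaf∉interior v∈leaves v∈interior
  where
  leaf∉interior : ∀ {v} → v ∈ map inj₁ (allFin n) → v ∉ map inj₂ (allFin k)
  leaf∉interior v∈leaves v∈interior with ∈-map⁻ inj₁ v∈leaves | ∈-map⁻ inj₂ v∈interior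
  ... | _ , _ , refl | _ , _ , ()

length-allVtx : ∀ n k → length (allVtx n k) ≡ n + k
length-allVtx n k = begin
  length (map inj₁ (allFin n) ++ map inj₂ (allFin k))
    ≡⟨ length-++ (map inj₁ (allFin n)) ⟩
  length (map inj₁ (allFin n)) + length (map inj₂ (allFin k))
    ≡⟨ cong₂ _+_ (trans (length-map inj₁ (allFin n)) (length-allFin n))
                 (trans (length-map inj₂ (allFin k)) (length-allFin k)) ⟩
  n + k ∎
  where open ≡-Reasoning

module _ {n k : ℕ} (T : BinaryPhyloTree n k) where

  open Forest (⊎-≡-dec _≟ᶠ_ _≟ᶠ_) (adj T) (adj-sym T) (adj-irr T) (acyclic T)

  degreeSum-allVtx : degreeSum (allVtx n k) ≡ n + 3 * k
  degreeSum-allVtx = begin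
    sum (map deg (map inj₁ (allFin n) ++ map inj₂ (allFin k)))
      ≡⟨ cong sum (map-++ deg (map inj₁ (allFin n)) (map inj₂ (allFin k))) ⟩
    sum (map deg (map inj₁ (allFin n)) ++ map deg (map inj₂ (allFin k)))
      ≡⟨ sum-++ (map deg (map inj₁ (allFin n))) _ ⟩
    sum (map deg (map inj₁ (allFin n))) + sum (map deg (map inj₂ (allFin k)))
      ≡⟨ cong₂ _+_ (cong sum (sym (map-∘ (allFin n)))) (cong sum (sym (map-∘ (allFin k)))) ⟩
    sum (map (deg ∘ inj₁) (allFin n)) + sum (map (deg ∘ inj₂) (allFin k))
      ≡⟨ cong₂ _+_ (sum-map-const (deg ∘ inj₁) (leaf-deg T) (allFin n))
                   (sum-map-const (deg ∘ inj₂) (interior-deg T) (allFin k)) ⟩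
    length (allFin n) * 1 + length (allFin k) * 3
      ≡⟨ cong₂ (λ a b → a * 1 + b * 3) (length-allFin n) (length-allFin k) ⟩
    n * 1 + k * 3
      ≡⟨ cong₂ _+_ (*-identityʳ n) (*-comm k 3) ⟩
    n + 3 * k ∎
    where
    open ≡-Reasoning
    deg = degreeIn (allVtx n k)

  interior≤leaves∸2 : k ≤ n ∸ 2
  interior≤leaves∸2 = n+3*k≤2*pred[n+k]⇒k≤n∸2 n k (begin
    n + 3 * k                         ≡⟨ sym degreeSum-allVtx ⟩
    degreeSum (allVtx n k)            ≤⟨ degreeSum≤2*pred[length] (allVtx n k) (Unique-allVtx n k) ⟩
    2 * pred (length (allVtx n k))    ≡⟨ cong (λ m → 2 * pred m) (length-allVtx n k) ⟩
    2 * pred (n + k)                  ∎)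
    where open ≤-Reasoning

module _ {n k : ℕ} (T : BinaryPhyloTree n k) where

  Pair : Set
  Pair = Fin n × Fin n

  _≟ᵖ_ : DecidableEquality Pair
  _≟ᵖ_ = ≡-dec _≟ᶠ_ _≟ᶠ_

  open Without _≟ᵖ_
  open import Data.List.Membership.DecPropositional _≟ᵖ_ using (_∈?_)

  SupportedBy : PairSet n → Fin k → Set
  SupportedBy 𝒯 i = ∃[ a ] ∃[ b ] ∃[ c ] Supports T 𝒯 a b c (inj₂ i)

  stored : ∀ {𝒯 a b} → (a , b) ∈ᵖ 𝒯 → Pair
  stored {a = a} {b} (inj₁ _) = a , b
  stored {a = a} {b} (inj₂ _) = b , a

  ∈ᵖ-removePair⁺ : ∀ {𝒯 a b p} (ab∈𝒯 : (a , b) ∈ᵖ 𝒯) → stored ab∈𝒯 ≢ p →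
    (a , b) ∈ᵖ removePair p 𝒯
  ∈ᵖ-removePair⁺ (inj₁ ab∈𝒯) ≢p = inj₁ (∈-without⁺ ab∈𝒯 ≢p)
  ∈ᵖ-removePair⁺ (inj₂ ba∈𝒯) ≢p = inj₂ (∈-without⁺ ba∈𝒯 ≢p)

  pairsOf : ∀ {𝒯 i} → SupportedBy 𝒯 i → List Pair
  pairsOf (_ , _ , _ , _ , _ , _ , ab , ac , bc) = stored ab ∷ stored ac ∷ stored bc ∷ []

  SupportedBy-removePair : ∀ {𝒯 i p} (s : SupportedBy 𝒯 i) → p ∉ pairsOf s →
    SupportedBy (removePair p 𝒯) i
  SupportedBy-removePair (a , b , c , a|b , a|c , b|c , ab , ac , bc) p∉ =
    a , b , c , a|b , a|c , b|c ,
    ∈ᵖ-removePair⁺ ab (λ { refl → p∉ (here refl) }) ,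
    ∈ᵖ-removePair⁺ ac (λ { refl → p∉ (there (here refl)) }) ,
    ∈ᵖ-removePair⁺ bc (λ { refl → p∉ (there (there (here refl))) })

  coverPairs : ∀ {𝒯} → IsTripletCover T 𝒯 → List Pair
  coverPairs cov = concatMap (pairsOf ∘ cov) (allFin k)

  length-coverPairs : ∀ {𝒯} (cov : IsTripletCover T 𝒯) → length (coverPairs cov) ≡ 3 * k
  length-coverPairs cov =
    trans (length-concatMap-const (pairsOf ∘ cov) (λ _ → refl) (allFin k))
          (trans (cong (_* 3) (length-allFin k)) (*-comm k 3))

  minimal⇒⊆coverPairs : ∀ {𝒯} ((cov , minimal) : IsMinimalTripletCover T 𝒯) → 𝒯 ⊆ coverPairs cov
  minimal⇒⊆coverPairs (cov , minimal) {p} p∈𝒯 with p ∈? coverPairs cov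
  ... | yes p∈ = p∈
  ... | no p∉ = ⊥-elim (minimal p p∈𝒯 λ i → SupportedBy-removePair (cov i) λ p∈i →
                  p∉ (∈-concat⁺′ p∈i (∈-map⁺ (pairsOf ∘ cov) (∈-allFin i))))

corollary1 : (n k : ℕ) → 3 ≤ n → (T : BinaryPhyloTree n k) → (𝒯 : PairSet n) →
    WellFormedPairSet 𝒯 → IsMinimalTripletCover T 𝒯 →
    length 𝒯 ≤ 3 * (n ∸ 2)
corollary1 n k _ T 𝒯 (_ , unique) minimal@(cov , _) = begin
  length 𝒯                   ≤⟨ unique⊆⇒length≤ unique (minimal⇒⊆coverPairs T minimal) ⟩
  length (coverPairs T cov)  ≡⟨ length-coverPairs T cov ⟩
  3 * k                      ≤⟨ *-monoʳ-≤ 3 (interior≤leaves∸2 T) ⟩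
  3 * (n ∸ 2)                ∎
  where
  open ≤-Reasoning
  open Without (≡-dec _≟ᶠ_ _≟ᶠ_) using (unique⊆⇒length≤)
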